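{- Let $\Theta_1,\Theta_2$ be normal s-substitutions such that $(\Theta_1,\Theta_2)$ is composable. Then $\Theta_1\star\Theta_2$ is normal, i.e. for every parameter assignment $\sigma$, $\mathrm{dom}((\Theta_1\star\Theta_2)[\sigma])\cap V^\iota(\mathrm{rg}((\Theta_1\star\Theta_2)[\sigma]))=\emptyset$.
   Context: Setting: parameters are variables of sort $\omega$; $T^\omega_0$ is the set of $\omega$-terms built from $\bar 0$, $s$ and parameters; a parameter assignment $\sigma$ maps parameters to numerals. Global variables $X$ have type $\omega^\gamma\to\iota$; a V-term is $X(s_1,\dots,s_\gamma)$; an individual variable is a V-term whose arguments are numerals. $T^\iota$ is the set of schematic $\iota$-terms (built from constants, V-terms, ordinary function symbols and primitive-recursively defined $\iota$-function symbols), and $\sigma(t){\downarrow_\iota}$ is the evaluation of $t\in T^\iota$ under $\sigma$, an ordinary first-order term over individual variables. An s-substitution is a finite set $\Theta$ of pairs $(X(\vec s),t)$ with $X$ a global variable, $\vec s$ a tuple over $T^\omega_0$, $t\in T^\iota$, such that distinct pairs with the same global variable have argument tuples that differ under every $\sigma$; $\Theta[\sigma]=\{X(\sigma(\vec s))\leftarrow\sigma(t){\downarrow_\iota}\mid(X(\vec s),t)\in\Theta\}$. For a substitution $\theta$, $\mathrm{dom}(\theta)$, $\mathrm{rg}(\theta)$ are the sets of bound variables and of terms they are bound to, and $V^\iota(\cdot)$ is the set of individual variables occurring. $\Theta$ is normal if $\mathrm{dom}(\Theta[\sigma])\cap V^\iota(\mathrm{rg}(\Theta[\sigma]))=\emptyset$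 for all $\sigma$. Normal $\Theta_1,\Theta_2$ are composable if for all $\sigma$: $\mathrm{dom}(\Theta_1[\sigma])\cap\mathrm{dom}(\Theta_2[\sigma])=\emptyset$ and $\mathrm{dom}(\Theta_1[\sigma])\cap V^\iota(\mathrm{rg}(\Theta_2[\sigma]))=\emptyset$. If $\Theta_1=\{(X_i(\vec s_i),t_i)\}_{i\le\alpha}$ and $\Theta_2=\{(Y_j(\vec w_j),r_j)\}_{j\le\beta}$, then $\Theta_1\star\Theta_2=\{(X_i(\vec s_i),t_i\Theta_2)\}_{i\le\alpha}\cup\Theta_2$, where $t_i\Theta_2$ is the schematic term whose instance under $\sigma$ is $(\sigma(t_i){\downarrow_\iota})\Theta_2[\sigma]$; so $(\Theta_1\star\Theta_2)[\sigma]=\{X_i(\sigma(\vec s_i))\leftarrow(\sigma(t_i){\downarrow_\iota})\Theta_2[\sigma]\}_{i\le\alpha}\cup\Theta_2[\sigma]$. -}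

module Defs where

open import Data.Nat using (ℕ; zero; suc)
import Data.Nat.Properties as ℕP
open import Data.Product using (Σ; _×_; _,_; proj₁; proj₂; map₁)
import Data.Product.Properties as ΣP
open import Data.Vec using (Vec; [] ; _∷_)
import Data.Vec as Vec
import Data.Vec.Properties as VecP
open import Data.List using (List; []; _∷_; map; _++_; concatMap)
open import Data.List.Membership.Propositional using (_∈_)
open import Data.List.Relation.Unary.AllPairs using (AllPairs)
open import Data.Maybe using (Maybe; just; nothing)
open import Data.Empty using (⊥)
open import Relation.Nullary using (yes; no; ¬_)
open import Relation.Binary.PropositionalEquality using (_≡_; _≢_)
open import Relation.Binary.Definitions using (DecidableEquality)

Param : Set
Param = ℕ

data Tω : Set where
  zeroω : Tω
  sω    : Tω → Tω
  par   : Param → Tω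

-- a parameter assignment maps parameters to numerals (numerals ≅ ℕ)
ParamAssign : Set
ParamAssign = Param → ℕ

evalω : ParamAssign → Tω → ℕ
evalω σ zeroω   = zero
evalω σ (sω s)  = suc (evalω σ s)
evalω σ (par k) = σ k

-- a global variable X : ω^γ → ι, given by a name and its arity γ
GVar : Set
GVar = ℕ × ℕ

arity : GVar → ℕ
arity = proj₂

VTerm : Set
VTerm = Σ GVar (λ X → Vec Tω (arity X))

-- individual variable: V-term whose arguments are numerals
IVar : Set
IVar = Σ GVar (λ X → Vec ℕ (arity X))

_≟IVar_ : DecidableEquality IVar
_≟IVar_ = ΣP.≡-dec (ΣP.≡-dec ℕP._≟_ ℕP._≟_) (VecP.≡-dec ℕP._≟_)

instV : ParamAssign → VTerm → IVar
instV σ (X , ss) = X , Vec.map (evalω σ) ss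

-- ordinary first-order ι-terms over individual variables
-- (constants are function symbols applied to no arguments)

data FOTerm : Set where
  var : IVar → FOTerm
  fun : ℕ → List FOTerm → FOTerm

mutual
  varsT : FOTerm → List IVar
  varsT (var x)    = x ∷ []
  varsT (fun f ts) = varsL ts

  varsL : List FOTerm → List IVar
  varsL []       = []
  varsL (t ∷ ts) = varsT t ++ varsL ts

Subst : Set
Subst = List (IVar × FOTerm)

dom : Subst → List IVar
dom = map proj₁

rg : Subst → List FOTerm
rg = map proj₂

lookupS : Subst → IVar → Maybe FOTerm
lookupS []             x = nothing
lookupS ((y , t) ∷ θ) x with x ≟IVar y
... | yes _ = just t
... | no  _ = lookupS θ x

mutual
  applyT : Subst → FOTerm → FOTerm
  applyT θ (var x) with lookupS θ x
  ... | just t  = t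
  ... | nothing = var x
  applyT θ (fun f ts) = fun f (applyL θ ts)

  applyL : Subst → List FOTerm → List FOTerm
  applyL θ []       = []
  applyL θ (t ∷ ts) = applyT θ t ∷ applyL θ ts

Disjoint : List IVar → List IVar → Set
Disjoint A B = ∀ x → x ∈ A → x ∈ B → ⊥

-- s-substitutions, relative to an arbitrary set Tι of schematic ι-terms
-- with evaluation ev σ t = σ(t)↓ι

module SSubst {Tι : Set} (ev : ParamAssign → Tι → FOTerm) where

  SPairs : Set
  SPairs = List (VTerm × Tι)

  -- distinct pairs with the same global variable have argument tuples
  -- that differ under every σ (pairs with distinct global variables
  -- automatically give distinct individual variables)
  IsSSubst : SPairs → Set
  IsSSubst = AllPairs (λ p q → ∀ (σ : ParamAssign) → instV σ (proj₁ p) ≢ instV σ (proj₁ q))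

  inst : SPairs → ParamAssign → Subst
  inst Θ σ = map (λ p → instV σ (proj₁ p) , ev σ (proj₂ p)) Θ

  NormalInst : Subst → Set
  NormalInst θ = Disjoint (dom θ) (varsL (rg θ))

  Normal : SPairs → Set
  Normal Θ = ∀ σ → NormalInst (inst Θ σ)

  Composable : SPairs → SPairs → Set
  Composable Θ₁ Θ₂ = ∀ σ →
    Disjoint (dom (inst Θ₁ σ)) (dom (inst Θ₂ σ)) ×
    Disjoint (dom (inst Θ₁ σ)) (varsL (rg (inst Θ₂ σ)))

  starInst : SPairs → SPairs → ParamAssign → Subst
  starInst Θ₁ Θ₂ σ =
    map (λ p → instV σ (proj₁ p) , applyT (inst Θ₂ σ) (ev σ (proj₂ p))) Θ₁
      ++ inst Θ₂ σ

module Submission where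

-- Normality of the composition Θ₁ ⋆ Θ₂ is a statement about each instance
-- separately, so the proof works entirely with ordinary first-order
-- substitutions.  For substitutions θ₁, θ₂ let θ₁ ⊙ θ₂ be the list
-- {x ← tθ₂ | (x ← t) ∈ θ₁} ∪ θ₂; by definition (Θ₁ ⋆ Θ₂)[σ] = Θ₁[σ] ⊙ Θ₂[σ].
--
-- Hence a variable of rg(θ₁ ⊙ θ₂) lies in
-- V^ι(rg θ₂), or in V^ι(rg θ₁) while being unbound by θ₂.  Together with
-- dom(θ₁ ⊙ θ₂) = dom θ₁ ∪ dom θ₂ this yields the general lemma
-- ⊙-normal: if θ₁, θ₂ are normal and dom θ₁ ∩ V^ι(rg θ₂) = ∅, then θ₁ ⊙ θ₂
-- is normal.

open import Defs
open import Data.Product using (_×_; _,_; proj₁; proj₂; ∃)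
open import Data.Sum using (_⊎_; inj₁; inj₂)
open import Data.List using ([]; _∷_; map; _++_)
open import Data.List.Properties using (map-++; map-∘)
open import Data.List.Membership.Propositional using (_∈_; _∉_)
open import Data.List.Membership.Propositional.Properties
  using (∈-map⁺; ∈-map⁻; ∈-++⁺ˡ; ∈-++⁺ʳ; ∈-++⁻)
open import Data.List.Relation.Unary.Any using (here; there)
open import Data.Maybe using (just; nothing)
open import Relation.Nullary using (yes; no)
open import Relation.Binary.PropositionalEquality
  using (_≡_; refl; sym; subst; cong; module ≡-Reasoning)
open ≡-Reasoning

varsL-∈ : ∀ {x t ts} → t ∈ ts → x ∈ varsT t → x ∈ varsL ts
varsL-∈ {ts = t ∷ ts} (here refl) x∈t = ∈-++⁺ˡ x∈t
varsL-∈ {ts = t ∷ ts} (there t∈ts) x∈t = ∈-++⁺ʳ (varsT t) (varsL-∈ t∈ts x∈t)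

varsL-∈⁻ : ∀ {x} ts → x ∈ varsL ts → ∃ λ t → t ∈ ts × x ∈ varsT t
varsL-∈⁻ (t ∷ ts) x∈ with ∈-++⁻ (varsT t) x∈
... | inj₁ x∈t = t , here refl , x∈t
... | inj₂ x∈ts with varsL-∈⁻ ts x∈ts
...   | u , u∈ts , x∈u = u , there u∈ts , x∈u

varsL-++⁻ : ∀ {x} ts us → x ∈ varsL (ts ++ us) → x ∈ varsL ts ⊎ x ∈ varsL us
varsL-++⁻ [] us x∈ = inj₂ x∈
varsL-++⁻ (t ∷ ts) us x∈ with ∈-++⁻ (varsT t) x∈
... | inj₁ x∈t = inj₁ (∈-++⁺ˡ x∈t)
... | inj₂ x∈rest with varsL-++⁻ ts us x∈rest
...   | inj₁ x∈ts = inj₁ (∈-++⁺ʳ (varsT t) x∈ts)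
...   | inj₂ x∈us = inj₂ x∈us

lookup-∈-rg : ∀ θ x {t} → lookupS θ x ≡ just t → t ∈ rg θ
lookup-∈-rg ((y , u) ∷ θ) x eq with x ≟IVar y
lookup-∈-rg ((y , u) ∷ θ) x refl | yes _ = here refl
... | no _ = there (lookup-∈-rg θ x eq)

lookup-nothing-∉-dom : ∀ θ x → lookupS θ x ≡ nothing → x ∉ dom θ
lookup-nothing-∉-dom ((y , u) ∷ θ) x eq x∈ with x ≟IVar y
lookup-nothing-∉-dom ((y , u) ∷ θ) x () x∈ | yes _
lookup-nothing-∉-dom ((y , u) ∷ θ) x eq (here x≡y) | no x≢y = x≢y x≡y
lookup-nothing-∉-dom ((y , u) ∷ θ) x eq (there x∈) | no _ =
  lookup-nothing-∉-dom θ x eq x∈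

mutual
  applyT-vars : ∀ θ t {x} → x ∈ varsT (applyT θ t) →
    (x ∈ varsT t × x ∉ dom θ) ⊎ x ∈ varsL (rg θ)
  applyT-vars θ (var y) x∈ with lookupS θ y in eq
  ... | just u = inj₂ (varsL-∈ (lookup-∈-rg θ y eq) x∈)
  applyT-vars θ (var y) (here refl) | nothing =
    inj₁ (here refl , lookup-nothing-∉-dom θ y eq)
  applyT-vars θ (fun f ts) x∈ = applyL-vars θ ts x∈

  applyL-vars : ∀ θ ts {x} → x ∈ varsL (applyL θ ts) →
    (x ∈ varsL ts × x ∉ dom θ) ⊎ x ∈ varsL (rg θ)
  applyL-vars θ (t ∷ ts) x∈ with ∈-++⁻ (varsT (applyT θ t)) x∈
  ... | inj₁ x∈tθ with applyT-vars θ t x∈tθ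
  ...   | inj₁ (x∈t , x∉θ) = inj₁ (∈-++⁺ˡ x∈t , x∉θ)
  ...   | inj₂ x∈rg = inj₂ x∈rg
  applyL-vars θ (t ∷ ts) x∈ | inj₂ x∈tsθ with applyL-vars θ ts x∈tsθ
  ...   | inj₁ (x∈ts , x∉θ) = inj₁ (∈-++⁺ʳ (varsT t) x∈ts , x∉θ)
  ...   | inj₂ x∈rg = inj₂ x∈rg

applyBinding : Subst → IVar × FOTerm → IVar × FOTerm
applyBinding θ (x , t) = x , applyT θ t

_⊙_ : Subst → Subst → Subst
θ₁ ⊙ θ₂ = map (applyBinding θ₂) θ₁ ++ θ₂

dom-⊙ : ∀ θ₁ θ₂ → dom (θ₁ ⊙ θ₂) ≡ dom θ₁ ++ dom θ₂
dom-⊙ θ₁ θ₂ = begin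
  map proj₁ (map (applyBinding θ₂) θ₁ ++ θ₂)
    ≡⟨ map-++ proj₁ (map (applyBinding θ₂) θ₁) θ₂ ⟩
  map proj₁ (map (applyBinding θ₂) θ₁) ++ dom θ₂
    ≡⟨ cong (_++ dom θ₂) (sym (map-∘ θ₁)) ⟩
  dom θ₁ ++ dom θ₂ ∎

rg-⊙ : ∀ θ₁ θ₂ → rg (θ₁ ⊙ θ₂) ≡ map (applyT θ₂) (rg θ₁) ++ rg θ₂
rg-⊙ θ₁ θ₂ = begin
  map proj₂ (map (applyBinding θ₂) θ₁ ++ θ₂)
    ≡⟨ map-++ proj₂ (map (applyBinding θ₂) θ₁) θ₂ ⟩
  map proj₂ (map (applyBinding θ₂) θ₁) ++ rg θ₂
    ≡⟨ cong (_++ rg θ₂) (sym (map-∘ θ₁)) ⟩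
  map (λ b → applyT θ₂ (proj₂ b)) θ₁ ++ rg θ₂
    ≡⟨ cong (_++ rg θ₂) (map-∘ θ₁) ⟩
  map (applyT θ₂) (rg θ₁) ++ rg θ₂ ∎

rg-⊙-vars : ∀ θ₁ θ₂ {x} → x ∈ varsL (rg (θ₁ ⊙ θ₂)) →
  x ∈ varsL (rg θ₂) ⊎ (x ∈ varsL (rg θ₁) × x ∉ dom θ₂)
rg-⊙-vars θ₁ θ₂ {x} x∈
  with varsL-++⁻ (map (applyT θ₂) (rg θ₁)) (rg θ₂)
                 (subst (λ ts → x ∈ varsL ts) (rg-⊙ θ₁ θ₂) x∈)
... | inj₂ x∈rg₂ = inj₁ x∈rg₂
... | inj₁ x∈rg₁θ₂ with varsL-∈⁻ (map (applyT θ₂) (rg θ₁)) x∈rg₁θ₂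
...   | _ , tθ₂∈ , x∈tθ₂ with ∈-map⁻ (applyT θ₂) tθ₂∈
...     | t , t∈rg₁ , refl with applyT-vars θ₂ t x∈tθ₂
...       | inj₁ (x∈t , x∉θ₂) = inj₂ (varsL-∈ t∈rg₁ x∈t , x∉θ₂)
...       | inj₂ x∈rg₂ = inj₁ x∈rg₂

⊙-normal : ∀ θ₁ θ₂ → Disjoint (dom θ₁) (varsL (rg θ₁)) →
  Disjoint (dom θ₂) (varsL (rg θ₂)) → Disjoint (dom θ₁) (varsL (rg θ₂)) →
  Disjoint (dom (θ₁ ⊙ θ₂)) (varsL (rg (θ₁ ⊙ θ₂)))
⊙-normal θ₁ θ₂ normal₁ normal₂ dom₁#rg₂ x x∈dom x∈rg
  with ∈-++⁻ (dom θ₁) (subst (x ∈_) (dom-⊙ θ₁ θ₂) x∈dom) | rg-⊙-vars θ₁ θ₂ x∈rg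
... | inj₁ x∈dom₁ | inj₁ x∈rg₂ = dom₁#rg₂ x x∈dom₁ x∈rg₂
... | inj₂ x∈dom₂ | inj₁ x∈rg₂ = normal₂ x x∈dom₂ x∈rg₂
... | inj₁ x∈dom₁ | inj₂ (x∈rg₁ , _) = normal₁ x x∈dom₁ x∈rg₁
... | inj₂ x∈dom₂ | inj₂ (_ , x∉dom₂) = x∉dom₂ x∈dom₂

starInst-⊙ : ∀ {Tι : Set} (ev : ParamAssign → Tι → FOTerm) Θ₁ Θ₂ σ →
  let open SSubst ev in starInst Θ₁ Θ₂ σ ≡ inst Θ₁ σ ⊙ inst Θ₂ σ
starInst-⊙ ev Θ₁ Θ₂ σ = cong (_++ SSubst.inst ev Θ₂ σ) (map-∘ Θ₁)

proposition8 : {Tι : Set} (ev : ParamAssign → Tι → FOTerm) →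
    let open SSubst ev in
    (Θ₁ Θ₂ : SPairs) → IsSSubst Θ₁ → IsSSubst Θ₂ →
    Normal Θ₁ → Normal Θ₂ → Composable Θ₁ Θ₂ →
    ∀ (σ : ParamAssign) → NormalInst (starInst Θ₁ Θ₂ σ)
proposition8 ev Θ₁ Θ₂ _ _ normal₁ normal₂ composable σ =
  subst NormalInst (sym (starInst-⊙ ev Θ₁ Θ₂ σ))
    (⊙-normal (inst Θ₁ σ) (inst Θ₂ σ)
      (normal₁ σ) (normal₂ σ) (proj₂ (composable σ)))
  where open SSubst ev
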